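{- Let the edges of the complete bipartite graph $K_{n,n}$ be coloured red and blue such that the red colour class is a vertex-disjoint union of stars. Then the vertex set of $K_{n,n}$ can be covered by three vertex-disjoint blue paths.
   Context: The red colour class is the graph formed by the red edges. A single vertex and the empty graph are considered paths (of every colour). -}

module Defs where

open import Data.Nat using (ℕ)
open import Data.Fin using (Fin)
open import Data.Bool using (Bool; true; false)
open import Data.Sum using (_⊎_; inj₁; inj₂)
open import Data.Product using (_×_; Σ; ∃-syntax; _,_)
open import Data.List using (List; []; _∷_; _++_)
open import Data.List.Membership.Propositional using (_∈_)
open import Data.List.Relation.Unary.Any using (Any)
open import Data.List.Relation.Unary.All using (All)
open import Data.List.Relation.Unary.Unique.Propositional using (Unique)
open import Data.List.Relation.Unary.AllPairs using (AllPairs)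
open import Data.Empty using (⊥)
open import Data.Unit using (⊤)
open import Relation.Binary.PropositionalEquality using (_≡_)
open import Relation.Nullary using (¬_)
open import Function.Bundles using (_⇔_)

-- Vertices of K_{n,n}: left side (inj₁) and right side (inj₂).
Vertex : ℕ → Set
Vertex n = Fin n ⊎ Fin n

-- A red/blue colouring of the edges of K_{n,n}:
-- colour i j = true  means the edge {left i, right j} is red,
-- colour i j = false means it is blue.
Colouring : ℕ → Set
Colouring n = Fin n → Fin n → Bool

RedAdj : ∀ {n} → Colouring n → Vertex n → Vertex n → Set
RedAdj c (inj₁ i) (inj₂ j) = c i j ≡ true
RedAdj c (inj₂ j) (inj₁ i) = c i j ≡ true
RedAdj c _        _        = ⊥

BlueAdj : ∀ {n} → Colouring n → Vertex n → Vertex n → Set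
BlueAdj c (inj₁ i) (inj₂ j) = c i j ≡ false
BlueAdj c (inj₂ j) (inj₁ i) = c i j ≡ false
BlueAdj c _        _        = ⊥

-- A star K_{1,k} (k ≥ 0): a centre and a list of leaves.
record Star (V : Set) : Set where
  constructor star
  field
    centre : V
    leaves : List V

open Star public

starVertices : ∀ {V} → Star V → List V
starVertices s = centre s ∷ leaves s

WellFormedStar : ∀ {V} → Star V → Set
WellFormedStar s = Unique (starVertices s)

StarAdj : ∀ {V} → Star V → V → V → Set
StarAdj s u v = (u ≡ centre s × v ∈ leaves s) ⊎ (v ≡ centre s × u ∈ leaves s)

Disjoint : ∀ {V : Set} → List V → List V → Set
Disjoint xs ys = ∀ {x} → x ∈ xs → x ∈ ys → ⊥

RedIsDisjointUnionOfStars : ∀ {n} → Colouring n → Set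
RedIsDisjointUnionOfStars {n} c =
  ∃[ ss ] (All WellFormedStar ss
          × AllPairs (λ s t → Disjoint (starVertices s) (starVertices t)) ss
          × (∀ (u v : Vertex n) → RedAdj c u v ⇔ Any (λ s → StarAdj s u v) ss))

BlueWalk : ∀ {n} → Colouring n → List (Vertex n) → Set
BlueWalk c []           = ⊤
BlueWalk c (x ∷ [])     = ⊤
BlueWalk c (x ∷ y ∷ xs) = BlueAdj c x y × BlueWalk c (y ∷ xs)

-- A blue path: a list of distinct vertices, consecutive ones joined by blue
-- edges. The empty list and single vertices are paths.
BluePath : ∀ {n} → Colouring n → List (Vertex n) → Set
BluePath c p = Unique p × BlueWalk c p

CoveredByThreeBluePaths : ∀ {n} → Colouring n → Set
CoveredByThreeBluePaths {n} c =
  ∃[ p₁ ] ∃[ p₂ ] ∃[ p₃ ]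
    (BluePath c p₁ × BluePath c p₂ × BluePath c p₃
    × Unique (p₁ ++ p₂ ++ p₃)
    × (∀ (v : Vertex n) → v ∈ p₁ ++ p₂ ++ p₃))

-- Give every vertex the key of the centre of its red star, list the left side
-- by increasing key and the right side by decreasing key, and alternate the two
-- lists.  Consecutive vertices are on opposite sides, so each step is blue or
-- red.  The two ends of a red step share a key, and along the alternation left
-- keys only grow while right keys only shrink; hence all red steps carry the
-- same key, i.e. lie in one star, and so all pass through its centre x.
-- Deleting x cuts the alternation into two blue paths, and {x} is the third.
module Submission where

open import Defs
open import Data.Nat using (ℕ; _≤_)
open import Data.Nat.Properties using (≤-refl; ≤-trans; ≤-antisym; ≤-reflexive; ≤-decTotalOrder; suc-injective)
open import Data.Fin as Fin using (Fin; toℕ; join; splitAt)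
open import Data.Fin.Properties using (toℕ-injective; splitAt-join)
open import Data.Bool using (true; false)
open import Data.Sum as Sum using (_⊎_; inj₁; inj₂; [_,_]′)
open import Data.Sum.Properties using (≡-dec)
open import Data.Product as Product using (_×_; ∃-syntax; _,_)
open import Data.Maybe using (just)
open import Data.Maybe.Relation.Binary.Connected using (Connected; just; just-nothing)
open import Data.List using (List; []; _∷_; _++_; [_]; map; length; allFin; head)
open import Data.List.Membership.Propositional using (_∈_; _∉_; find)
open import Data.List.Membership.Propositional.Properties using (∈-map⁺; ∈-∃++; ∈-allFin)
open import Data.List.Relation.Unary.Any using (Any; here; there)
open import Data.List.Relation.Unary.All as All using (All; []; _∷_)
import Data.List.Relation.Unary.All.Properties as All
open import Data.List.Relation.Unary.AllPairs as AllPairs using (AllPairs; []; _∷_)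
import Data.List.Relation.Unary.AllPairs.Properties as AllPairs
open import Data.List.Relation.Unary.Linked as Linked using (Linked; []; [-]; _∷_; _∷′_)
open import Data.List.Relation.Unary.Unique.Propositional using (Unique)
open import Data.List.Relation.Unary.Unique.Propositional.Properties using (allFin⁺; Unique[x∷xs]⇒x∉xs)
open import Data.List.Relation.Unary.Sorted.TotalOrder.Properties using (Sorted⇒AllPairs)
open import Data.List.Relation.Binary.Permutation.Propositional using (_↭_; ↭-sym; ↭⇒↭ₛ)
open import Data.List.Relation.Binary.Permutation.Propositional.Properties using (∈-resp-↭; ↭-length)
open import Data.List.Relation.Binary.Permutation.Setoid.Properties using (Unique-resp-↭)
import Data.List.Sort as Sort
open import Data.Empty using (⊥-elim)
open import Data.Unit using (⊤; tt)
open import Function using (_∘_; _on_)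
open import Function.Bundles using (Equivalence)
open import Relation.Binary.Bundles using (DecTotalOrder)
open import Relation.Binary.Definitions using (DecidableEquality)
open import Relation.Binary.PropositionalEquality using (_≡_; _≢_; refl; sym; trans; cong; setoid; module ≡-Reasoning)
import Relation.Binary.Construct.On as On
import Relation.Binary.Construct.Flip.EqAndOrd as Flip
open import Relation.Nullary using (yes; no)

antisym-across : ∀ {a b a′ b′ : ℕ} → a ≡ b → a′ ≡ b′ → a ≤ a′ → b′ ≤ b → a′ ≡ a
antisym-across a≡b a′≡b′ a≤a′ b′≤b =
  ≤-antisym (≤-trans (≤-reflexive a′≡b′) (≤-trans b′≤b (≤-reflexive (sym a≡b)))) a≤a′

module _ {A : Set} where

  Linked-++⁻ : ∀ {R : A → A → Set} xs {ys} → Linked R (xs ++ ys) → Linked R xs × Linked R ys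
  Linked-++⁻ []           l       = [] , l
  Linked-++⁻ (_ ∷ [])     l       = [-] , Linked.tail l
  Linked-++⁻ (_ ∷ y ∷ xs) (r ∷ l) = Product.map₁ (r ∷_) (Linked-++⁻ (y ∷ xs) l)

  Unique-++⁻ : ∀ xs {ys : List A} → Unique (xs ++ ys) → Unique xs × Unique ys × Disjoint xs ys
  Unique-++⁻ []       u          = [] , u , λ ()
  Unique-++⁻ (x ∷ xs) (x∉ ∷ u) with Unique-++⁻ xs u
  ... | uxs , uys , disjoint =
    All.++⁻ˡ xs x∉ ∷ uxs , uys ,
    λ { (here refl) x∈ys → All.lookup (All.++⁻ʳ xs x∉) x∈ys refl ; (there z∈xs) z∈ys → disjoint z∈xs z∈ys }

  Incident : A → A → A → Set
  Incident x u v = u ≡ x ⊎ v ≡ x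

  Linked-avoiding : ∀ {R : A → A → Set} {x xs} → x ∉ xs →
                    Linked (λ u v → R u v ⊎ Incident x u v) xs → Linked R xs
  Linked-avoiding x∉ []      = []
  Linked-avoiding x∉ [-]     = [-]
  Linked-avoiding {R} {x} {u ∷ v ∷ _} x∉ (s ∷ l) = step s ∷ Linked-avoiding (x∉ ∘ there) l
    where
    step : R u v ⊎ Incident x u v → R u v
    step (inj₁ r)           = r
    step (inj₂ (inj₁ refl)) = ⊥-elim (x∉ (here refl))
    step (inj₂ (inj₂ refl)) = ⊥-elim (x∉ (there (here refl)))

module _ {A B : Set} where

  interleave : List A → List B → List (A ⊎ B)
  interleave []       bs       = map inj₂ bs
  interleave (a ∷ as) []       = map inj₁ (a ∷ as)
  interleave (a ∷ as) (b ∷ bs) = inj₁ a ∷ inj₂ b ∷ interleave as bs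

  OnEachSide : (A → A → Set) → (B → B → Set) → A ⊎ B → A ⊎ B → Set
  OnEachSide R S (inj₁ a) (inj₁ a′) = R a a′
  OnEachSide R S (inj₂ b) (inj₂ b′) = S b b′
  OnEachSide R S _        _         = ⊤

  ∈-interleave⁺ˡ : ∀ {a as bs} → a ∈ as → inj₁ a ∈ interleave as bs
  ∈-interleave⁺ˡ {as = _ ∷ _}  {[]}     a∈          = ∈-map⁺ inj₁ a∈
  ∈-interleave⁺ˡ {bs = _ ∷ _}           (here refl) = here refl
  ∈-interleave⁺ˡ {as = _ ∷ as} {_ ∷ bs} (there a∈)  = there (there (∈-interleave⁺ˡ {as = as} {bs} a∈))

  ∈-interleave⁺ʳ : ∀ {b as bs} → b ∈ bs → inj₂ b ∈ interleave as bs
  ∈-interleave⁺ʳ {as = []}              b∈          = ∈-map⁺ inj₂ b∈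
  ∈-interleave⁺ʳ {as = _ ∷ _}           (here refl) = there (here refl)
  ∈-interleave⁺ʳ {as = _ ∷ as} {_ ∷ bs} (there b∈)  = there (there (∈-interleave⁺ʳ {as = as} {bs} b∈))

  All-interleave⁺ : ∀ {P : A ⊎ B → Set} {as bs} →
                    All (P ∘ inj₁) as → All (P ∘ inj₂) bs → All P (interleave as bs)
  All-interleave⁺ {as = []}    _          pbs        = All.map⁺ pbs
  All-interleave⁺ {as = _ ∷ _} pas        []         = All.map⁺ pas
  All-interleave⁺ {P = P} (pa ∷ pas) (pb ∷ pbs) = pa ∷ pb ∷ All-interleave⁺ {P = P} pas pbs

  AllPairs-interleave⁺ : ∀ {R S as bs} → AllPairs R as → AllPairs S bs →
                         AllPairs (OnEachSide R S) (interleave as bs)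
  AllPairs-interleave⁺ {as = []}    _            Sbs          = AllPairs.map⁺ Sbs
  AllPairs-interleave⁺ {as = _ ∷ _} Ras          []           = AllPairs.map⁺ Ras
  AllPairs-interleave⁺ {R} {S} {_ ∷ as} {_ ∷ bs} (Ra ∷ Ras) (Sb ∷ Sbs) =
    (tt ∷ All-interleave⁺ Ra (All.tabulate λ _ → tt))
    ∷ All-interleave⁺ {as = as} (All.tabulate λ _ → tt) Sb
    ∷ AllPairs-interleave⁺ {R} {S} Ras Sbs

  Unique-interleave⁺ : ∀ {as bs} → Unique as → Unique bs → Unique (interleave as bs)
  Unique-interleave⁺ uas ubs = AllPairs.map ≢-on-each-side (AllPairs-interleave⁺ uas ubs)
    where
    ≢-on-each-side : ∀ {u v} → OnEachSide _≢_ _≢_ u v → u ≢ v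
    ≢-on-each-side {inj₁ _} {inj₁ _} a≢a′ refl = a≢a′ refl
    ≢-on-each-side {inj₂ _} {inj₂ _} b≢b′ refl = b≢b′ refl
    ≢-on-each-side {inj₁ _} {inj₂ _} _ ()
    ≢-on-each-side {inj₂ _} {inj₁ _} _ ()

  Linked-interleave⁺ : ∀ {R : A ⊎ B → A ⊎ B → Set} →
                       (∀ a b → R (inj₁ a) (inj₂ b)) → (∀ a b → R (inj₂ b) (inj₁ a)) →
                       ∀ {as bs} → length as ≡ length bs → Linked R (interleave as bs)
  Linked-interleave⁺     R₁₂ R₂₁ {[]}     {[]}     _  = []
  Linked-interleave⁺ {R} R₁₂ R₂₁ {a ∷ as} {b ∷ bs} eq =
    R₁₂ a b ∷ (continues {as} {bs} (suc-injective eq) ∷′ Linked-interleave⁺ R₁₂ R₂₁ {as} {bs} (suc-injective eq))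
    where
    continues : ∀ {as bs} → length as ≡ length bs → Connected R (just (inj₂ b)) (head (interleave as bs))
    continues {[]}     {[]}    _ = just-nothing
    continues {a′ ∷ _} {_ ∷ _} _ = just (R₂₁ a′ b)

module SortedFins {a ℓ₁ ℓ₂} (O : DecTotalOrder a ℓ₁ ℓ₂) {m} (f : Fin m → DecTotalOrder.Carrier O) where

  open DecTotalOrder O using () renaming (_≤_ to _≤ᴼ_)

  private
    O-on-f : DecTotalOrder _ _ _
    O-on-f = On.decTotalOrder O f

  sorted : List (Fin m)
  sorted = Sort.sort O-on-f (allFin m)

  sorted-↭ : sorted ↭ allFin m
  sorted-↭ = Sort.sort-↭ O-on-f (allFin m)

  sorted-ordered : AllPairs (λ i j → f i ≤ᴼ f j) sorted
  sorted-ordered = Sorted⇒AllPairs (DecTotalOrder.totalOrder O-on-f) (Sort.sort-↗ O-on-f (allFin m))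

  sorted-unique : Unique sorted
  sorted-unique = Unique-resp-↭ (setoid (Fin m)) (↭⇒↭ₛ (↭-sym sorted-↭)) (allFin⁺ m)

  ∈-sorted : ∀ i → i ∈ sorted
  ∈-sorted i = ∈-resp-↭ (↭-sym sorted-↭) (∈-allFin i)

  length-sorted : length sorted ≡ length (allFin m)
  length-sorted = ↭-length sorted-↭

module _ {V : Set} where

  ThroughCentre : (V → V) → V → V → Set
  ThroughCentre ctr u v = (ctr u ≡ u × ctr v ≡ u) ⊎ (ctr u ≡ v × ctr v ≡ v)

  throughCentre⇒sameCentre : ∀ {ctr u v} → ThroughCentre ctr u v → ctr u ≡ ctr v
  throughCentre⇒sameCentre (inj₁ (cu≡u , cv≡u)) = trans cu≡u (sym cv≡u)
  throughCentre⇒sameCentre (inj₂ (cu≡v , cv≡v)) = trans cu≡v (sym cv≡v)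

  throughCentre⇒incident : ∀ {ctr u v x} → ThroughCentre ctr u v → ctr u ≡ x → Incident x u v
  throughCentre⇒incident (inj₁ (cu≡u , _)) cu≡x = inj₁ (trans (sym cu≡u) cu≡x)
  throughCentre⇒incident (inj₂ (cu≡v , _)) cu≡x = inj₂ (trans (sym cu≡v) cu≡x)

  module _ (_≟_ : DecidableEquality V) where

    open import Data.List.Membership.DecPropositional _≟_ using (_∈?_)

    centreOf : List (Star V) → V → V
    centreOf []       v = v
    centreOf (s ∷ ss) v with v ∈? starVertices s
    ... | yes _ = centre s
    ... | no  _ = centreOf ss v

    centreOf-∈ : ∀ {ss s v} → AllPairs (Disjoint on starVertices) ss →
                 s ∈ ss → v ∈ starVertices s → centreOf ss v ≡ centre s
    centreOf-∈ {t ∷ _} {v = v} _ _ _ with v ∈? starVertices t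
    centreOf-∈ _              (here refl) _  | yes _   = refl
    centreOf-∈ (t#ss ∷ _)     (there s∈)  v∈ | yes v∈t = ⊥-elim (All.lookup t#ss s∈ v∈t v∈)
    centreOf-∈ _              (here refl) v∈ | no  v∉t = ⊥-elim (v∉t v∈)
    centreOf-∈ (_ ∷ disjoint) (there s∈)  v∈ | no  _   = centreOf-∈ disjoint s∈ v∈

    starEdge⇒throughCentre : ∀ {ss u v} → AllPairs (Disjoint on starVertices) ss →
                             Any (λ s → StarAdj s u v) ss → ThroughCentre (centreOf ss) u v
    starEdge⇒throughCentre disjoint e with find e
    ... | s , s∈ , inj₁ (refl , v∈) =
      inj₁ (centreOf-∈ disjoint s∈ (here refl) , centreOf-∈ disjoint s∈ (there v∈))
    ... | s , s∈ , inj₂ (refl , u∈) =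
      inj₂ (centreOf-∈ disjoint s∈ (there u∈) , centreOf-∈ disjoint s∈ (here refl))

module _ {n} (c : Colouring n) where

  BlueOrRed : Vertex n → Vertex n → Set
  BlueOrRed u v = BlueAdj c u v ⊎ RedAdj c u v

  blueOrRed : ∀ i j → BlueOrRed (inj₁ i) (inj₂ j)
  blueOrRed i j with c i j
  ... | true  = inj₂ refl
  ... | false = inj₁ refl

  Linked⇒BlueWalk : ∀ {xs} → Linked (BlueAdj c) xs → BlueWalk c xs
  Linked⇒BlueWalk []      = tt
  Linked⇒BlueWalk [-]     = tt
  Linked⇒BlueWalk (b ∷ l) = b , Linked⇒BlueWalk l

  oneBluePath : ∀ {xs} → Unique xs → (∀ v → v ∈ xs) → Linked (BlueAdj c) xs →
                CoveredByThreeBluePaths c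
  oneBluePath {xs} u cover l = [] , [] , xs , ([] , tt) , ([] , tt) , (u , Linked⇒BlueWalk l) , u , cover

  threeBluePaths : ∀ x {xs} → Unique xs → (∀ v → v ∈ xs) →
                   Linked (λ u v → BlueAdj c u v ⊎ Incident x u v) xs → CoveredByThreeBluePaths c
  threeBluePaths x u cover l with ∈-∃++ (cover x)
  ... | pre , post , refl with Unique-++⁻ pre u | Linked-++⁻ pre l
  ...   | upre , ux∷post@(_ ∷ upost) , disjoint | lpre , lx∷post =
    pre , [ x ] , post
    , (upre , Linked⇒BlueWalk (Linked-avoiding (λ x∈ → disjoint x∈ (here refl)) lpre))
    , ([] ∷ [] , tt)
    , (upost , Linked⇒BlueWalk (Linked-avoiding (Unique[x∷xs]⇒x∉xs ux∷post) (Linked.tail lx∷post)))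
    , u , cover

  module Zigzag (key : Vertex n → ℕ) (key-red : ∀ {u v} → RedAdj c u v → key u ≡ key v) where

    _≼_ : Vertex n → Vertex n → Set
    _≼_ = OnEachSide (λ i i′ → key (inj₁ i) ≤ key (inj₁ i′)) (λ j j′ → key (inj₂ j′) ≤ key (inj₂ j))

    ≼-refl : ∀ v → v ≼ v
    ≼-refl (inj₁ _) = ≤-refl
    ≼-refl (inj₂ _) = ≤-refl

    redStep-key : ∀ {u v w w′} → RedAdj c u v → RedAdj c w w′ →
                  u ≼ w → u ≼ w′ → v ≼ w → v ≼ w′ → key w ≡ key u
    redStep-key {inj₁ _} {inj₂ _} {inj₁ _} {inj₂ _} r r′ u≼w _ _ v≼w′ =
      antisym-across (key-red r) (key-red r′) u≼w v≼w′
    redStep-key {inj₁ _} {inj₂ _} {inj₂ _} {inj₁ _} r r′ _ u≼w′ v≼w _ =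
      trans (key-red r′) (antisym-across (key-red r) (sym (key-red r′)) u≼w′ v≼w)
    redStep-key {inj₂ _} {inj₁ _} {inj₁ _} {inj₂ _} r r′ _ u≼w′ v≼w _ =
      trans (antisym-across (sym (key-red r)) (key-red r′) v≼w u≼w′) (sym (key-red r))
    redStep-key {inj₂ _} {inj₁ _} {inj₂ _} {inj₁ _} r r′ u≼w _ _ v≼w′ =
      trans (key-red r′) (trans (antisym-across (sym (key-red r)) (sym (key-red r′)) v≼w′ u≼w) (sym (key-red r)))
    redStep-key {inj₁ _} {inj₁ _} () _ _ _ _ _
    redStep-key {inj₂ _} {inj₂ _} () _ _ _ _ _
    redStep-key {w = inj₁ _} {inj₁ _} _ () _ _ _ _
    redStep-key {w = inj₂ _} {inj₂ _} _ () _ _ _ _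

    BlueOrRedOfKey : ℕ → Vertex n → Vertex n → Set
    BlueOrRedOfKey k u v = BlueAdj c u v ⊎ (RedAdj c u v × key u ≡ k)

    redSteps-after : ∀ {u v ys} → RedAdj c u v → All (u ≼_) ys → All (v ≼_) ys →
                     Linked BlueOrRed ys → Linked (BlueOrRedOfKey (key u)) ys
    redSteps-after r _            _            []      = []
    redSteps-after r _            _            [-]     = [-]
    redSteps-after {u} {ys = w ∷ w′ ∷ _} r (u≼w ∷ u≼ws) (v≼w ∷ v≼ws) (s ∷ l) =
      keyed s ∷ redSteps-after r u≼ws v≼ws l
      where
      keyed : BlueOrRed w w′ → BlueOrRedOfKey (key u) w w′
      keyed (inj₁ b)  = inj₁ b
      keyed (inj₂ r′) = inj₂ (r′ , redStep-key r r′ u≼w (All.head u≼ws) v≼w (All.head v≼ws))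

    redSteps-shareKey : ∀ {xs} → AllPairs _≼_ xs → Linked BlueOrRed xs →
                        Linked (BlueAdj c) xs ⊎ ∃[ u ] Linked (BlueOrRedOfKey (key u)) xs
    redSteps-shareKey _ [] = inj₁ []
    redSteps-shareKey _ [-] = inj₁ [-]
    redSteps-shareKey {u ∷ v ∷ _} (u≼ ∷ v≼ ∷ _) (inj₂ r ∷ l) =
      inj₂ (u , inj₂ (r , refl) ∷ redSteps-after r u≼ (≼-refl v ∷ v≼) l)
    redSteps-shareKey (_ ∷ ≼s) (inj₁ b ∷ l) =
      Sum.map (b ∷_) (Product.map₂ (inj₁ b ∷_)) (redSteps-shareKey ≼s l)

    module Left  = SortedFins ≤-decTotalOrder (key ∘ inj₁)
    module Right = SortedFins (Flip.decTotalOrder ≤-decTotalOrder) (key ∘ inj₂)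

    zigzag : List (Vertex n)
    zigzag = interleave Left.sorted Right.sorted

    zigzag-unique : Unique zigzag
    zigzag-unique = Unique-interleave⁺ Left.sorted-unique Right.sorted-unique

    zigzag-complete : ∀ v → v ∈ zigzag
    zigzag-complete (inj₁ i) = ∈-interleave⁺ˡ {bs = Right.sorted} (Left.∈-sorted i)
    zigzag-complete (inj₂ j) = ∈-interleave⁺ʳ {as = Left.sorted} (Right.∈-sorted j)

    zigzag-monotone : AllPairs _≼_ zigzag
    zigzag-monotone = AllPairs-interleave⁺ Left.sorted-ordered Right.sorted-ordered

    zigzag-blueOrRed : Linked BlueOrRed zigzag
    zigzag-blueOrRed =
      Linked-interleave⁺ blueOrRed blueOrRed {Left.sorted} {Right.sorted}
        (trans Left.length-sorted (sym Right.length-sorted))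

  throughCentres⇒coveredByThreeBluePaths : (ctr : Vertex n → Vertex n) →
    (∀ {u v} → RedAdj c u v → ThroughCentre ctr u v) → CoveredByThreeBluePaths c
  throughCentres⇒coveredByThreeBluePaths ctr through =
    [ oneBluePath zigzag-unique zigzag-complete
    , (λ (u , l) → threeBluePaths (ctr u) zigzag-unique zigzag-complete (Linked.map (incident u) l)) ]′
    (redSteps-shareKey zigzag-monotone zigzag-blueOrRed)
    where
    key : Vertex n → ℕ
    key v = toℕ (join n n (ctr v))

    key-red : ∀ {u v} → RedAdj c u v → key u ≡ key v
    key-red r = cong (toℕ ∘ join n n) (throughCentre⇒sameCentre (through r))

    sameKey⇒sameCentre : ∀ {u v} → key u ≡ key v → ctr u ≡ ctr v
    sameKey⇒sameCentre {u} {v} eq = let open ≡-Reasoning in begin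
      ctr u                           ≡⟨ splitAt-join n n (ctr u) ⟨
      splitAt n (join n n (ctr u))    ≡⟨ cong (splitAt n) (toℕ-injective eq) ⟩
      splitAt n (join n n (ctr v))    ≡⟨ splitAt-join n n (ctr v) ⟩
      ctr v                           ∎

    open Zigzag key key-red

    incident : ∀ u {w w′} → BlueOrRedOfKey (key u) w w′ → BlueAdj c w w′ ⊎ Incident (ctr u) w w′
    incident u (inj₁ b)           = inj₁ b
    incident u (inj₂ (r , kw≡ku)) = inj₂ (throughCentre⇒incident (through r) (sameKey⇒sameCentre kw≡ku))

lemma5p13 : (n : ℕ) (c : Colouring n) → RedIsDisjointUnionOfStars c
    → CoveredByThreeBluePaths c
lemma5p13 n c (stars , _ , disjoint , red⇔) =
  throughCentres⇒coveredByThreeBluePaths c (centreOf _≟_ stars)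
    (λ r → starEdge⇒throughCentre _≟_ disjoint (Equivalence.to (red⇔ _ _) r))
  where
  _≟_ : DecidableEquality (Vertex n)
  _≟_ = ≡-dec Fin._≟_ Fin._≟_
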